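{- For every orbit $L$ of the reverted action of $B_\infty\times B_\infty$ on $S_{2\infty}\times S_{2\infty}$, the set $L\cap(S_{2m_L}\times S_{2m_L})$ is non-empty, where $m_L$ is the magnitude of $L$.
   Context: $S_{2\infty}$ is the group of finitely supported permutations of the positive integers and $S_{2n}$ its subgroup of permutations of $[2n]$; $B_n\subseteq S_{2n}$ is the centralizer of $(1\,2)(3\,4)\cdots(2n-1\,2n)$ and $B_\infty=\bigcup_nB_n$. The reverted action is $(a,b)\cdot_r(x,y)=(axb^{ -1},bya^{ -1})$. Partner map $t(2i-1)=2i$, $t(2i)=2i-1$; couples $D_i=\{2i-1,2i\}$, $\mathbb{D}=\{D_i\}$; $S(x)=\{i:x(i)\ne i\}$, $D(x)=\{D_i\in\mathbb{D}:x(D_i)\notin\mathbb{D}\}$, $DS(x)=\bigcup_{D_i\in D(x)}D_i$. The magnitude $m_L$ of a reverted orbit $L$ is defined by $2m_L=|S(xy)|+|t(S(xy))|+|DS(x)|+|DS(y)|$ for any $(x,y)\in L$ (this does not depend on the choice of $(x,y)$). -}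

module Defs where

open import Data.Nat using (ℕ; zero; suc; _+_; _*_; _≤_; _≟_)
open import Data.Bool using (if_then_else_)
open import Data.Product using (_×_; ∃-syntax)
open import Relation.Nullary using (does)
open import Relation.Binary.PropositionalEquality using (_≡_)
open import Function.Bundles using (_↔_; Inverse)

-- Convention: the positive integer k is represented by the natural number k ∸ 1.
-- Hence the couple D_{j+1} = {2j+1, 2j+2} becomes {2j, 2j+1}, and [2n] becomes {0,…,2n-1}.

Perm : Set
Perm = ℕ ↔ ℕ

app : Perm → ℕ → ℕ
app = Inverse.to

inv : Perm → ℕ → ℕ
inv = Inverse.from

-- partner map t (swaps 2j and 2j+1, i.e. 2i-1 and 2i in 1-based terms)
t : ℕ → ℕ
t zero = 1
t (suc zero) = 0
t (suc (suc n)) = suc (suc (t n))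

SupportedBelow : ℕ → (ℕ → ℕ) → Set
SupportedBelow n f = ∀ i → n ≤ i → f i ≡ i

InS∞ : Perm → Set
InS∞ x = ∃[ n ] SupportedBelow n (app x)

InS : ℕ → (ℕ → ℕ) → Set
InS n f = SupportedBelow (2 * n) f

InB∞ : Perm → Set
InB∞ a = InS∞ a × (∀ i → app a (t i) ≡ t (app a i))

revL : Perm → Perm → Perm → ℕ → ℕ
revL a b x i = app a (app x (inv b i))

revR : Perm → Perm → Perm → ℕ → ℕ
revR a b y i = app b (app y (inv a i))

-- product xy (apply y first)
mul : Perm → Perm → ℕ → ℕ
mul x y i = app x (app y i)

neq : ℕ → ℕ → ℕ
neq m n = if does (m ≟ n) then 0 else 1

sumBelow : ℕ → (ℕ → ℕ) → ℕ
sumBelow zero f = 0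
sumBelow (suc n) f = sumBelow n f + f n

-- |S(z)|, counted inside {0,…,n-1} (correct when z is supported below n)
cardS : (ℕ → ℕ) → ℕ → ℕ
cardS z n = sumBelow n (λ i → neq (z i) i)

-- |t(S(z))|, counted inside {0,…,n-1}: i ∈ t(S(z)) iff t i ∈ S(z) (t is an involution)
cardtS : (ℕ → ℕ) → ℕ → ℕ
cardtS z n = sumBelow n (λ i → neq (z (t i)) (t i))

-- 1 if the couple D_j = {2j, 2j+1} belongs to D(x), i.e. x(D_j) is not a couple;
-- x(D_j) = {x(2j), x(2j+1)} is a couple iff x(2j+1) = t(x(2j)).
inD : Perm → ℕ → ℕ
inD x j = neq (t (app x (2 * j))) (app x (suc (2 * j)))

-- |DS(x)| = Σ over couples D_j (j < N) in D(x) of |D_j| = 2, correct when x supported below 2N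
cardDS : Perm → ℕ → ℕ
cardDS x N = sumBelow N (λ j → 2 * inD x j)

-- 2 m_L = |S(xy)| + |t(S(xy))| + |DS(x)| + |DS(y)|, for (x,y) supported below 2N
twiceMagnitude : Perm → Perm → ℕ → ℕ
twiceMagnitude x y N =
  cardS (mul x y) (2 * N) + cardtS (mul x y) (2 * N) + cardDS x N + cardDS y N

module Submission where

-- Call a couple D_q of a pair (x,y) *settled* if xy fixes both points of D_q and y maps
-- D_q onto a couple.  The number of defects of D_q (points of D_q moved by xy, plus 1 if
-- y(D_q) is not a couple) is counted at least twice in 2 m_L, so the total number of
-- defects among the first N couples is at most m_L.  If (x,y) lives in S_{2N} × S_{2N} and N > m_L,
-- some couple D_i with i < N is settled.  Let y map D_i onto D_k.  Acting by the couple swaps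
-- a = (D_i ↔ D_{N-1}) and b = (D_k ↔ D_{N-1}) (the latter crossing sides if needed), both in
-- B∞, yields an orbit representative fixing D_{N-1} pointwise, i.e. living in S_{2(N-1)},
-- whose defects are those of (x,y) relabelled by the transposition (i N-1).  Induction on N
-- then reaches N ≤ m_L, where the identity elements of B∞ do the job.

open import Defs
open import Data.Nat using (ℕ; zero; suc; _+_; _*_; _≤_; _<_; _≟_; _≤?_; ⌊_/2⌋; z≤n; s≤s)
open import Data.Nat.Properties
open import Data.Nat.Tactic.RingSolver using (solve-∀)
open import Data.Bool using (Bool; true; false; not; _xor_; if_then_else_)
open import Data.Bool.Properties using (xor-assoc; xor-same; xor-identityʳ; not-distribˡ-xor)
open import Data.Product using (_×_; _,_; ∃-syntax)
open import Data.Sum using (_⊎_; inj₁; inj₂)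
open import Relation.Nullary using (yes; no; contradiction)
open import Relation.Nullary.Decidable using (dec-true; dec-false)
open import Relation.Binary.PropositionalEquality
open import Function.Base using (_∘_)
open import Function.Bundles using (Inverse; mk↔ₛ′)
open import Function.Construct.Composition using (_↔-∘_)
open import Function.Construct.Identity using (↔-id)
open import Function.Construct.Symmetry using (↔-sym)
open import Algebra.Properties.CommutativeSemigroup +-commutativeSemigroup using (xy∙z≈xz∙y; interchange)

couple : ℕ → Bool → ℕ
couple q false = 2 * q
couple q true  = suc (2 * q)

side : ℕ → Bool
side zero          = false
side (suc zero)    = true
side (suc (suc p)) = side p

couple-suc : ∀ q r → couple (suc q) r ≡ suc (suc (couple q r))
couple-suc q false = *-suc 2 q
couple-suc q true  = cong suc (*-suc 2 q)

couple-coords : ∀ p → couple ⌊ p /2⌋ (side p) ≡ p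
couple-coords zero          = refl
couple-coords (suc zero)    = refl
couple-coords (suc (suc p)) =
  trans (couple-suc ⌊ p /2⌋ (side p)) (cong (λ u → suc (suc u)) (couple-coords p))

⌊couple/2⌋ : ∀ q r → ⌊ couple q r /2⌋ ≡ q
⌊couple/2⌋ zero    false = refl
⌊couple/2⌋ zero    true  = refl
⌊couple/2⌋ (suc q) r rewrite couple-suc q r = cong suc (⌊couple/2⌋ q r)

side-couple : ∀ q r → side (couple q r) ≡ r
side-couple zero    false = refl
side-couple zero    true  = refl
side-couple (suc q) r rewrite couple-suc q r = side-couple q r

t-couple : ∀ q r → t (couple q r) ≡ couple q (not r)
t-couple zero    false = refl
t-couple zero    true  = refl
t-couple (suc q) r rewrite couple-suc q r | couple-suc q (not r) =
  cong (λ u → suc (suc u)) (t-couple q r)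

couple-< : ∀ {q N} r → q < N → couple q r < 2 * N
couple-< {q} {N} r q<N = ≤-trans (s≤s (≤-side r)) (subst (_≤ 2 * N) (*-suc 2 q) (*-monoʳ-≤ 2 q<N))
  where
  ≤-side : ∀ r → couple q r ≤ suc (2 * q)
  ≤-side false = n≤1+n _
  ≤-side true  = ≤-refl

couple-≥ : ∀ {q N} r → N ≤ q → 2 * N ≤ couple q r
couple-≥ false N≤q = *-monoʳ-≤ 2 N≤q
couple-≥ true  N≤q = m≤n⇒m≤1+n (*-monoʳ-≤ 2 N≤q)

couple-<⁻¹ : ∀ {q N} r → couple q r < 2 * N → q < N
couple-<⁻¹ {q} {N} r lt with N ≤? q
... | yes N≤q = contradiction (couple-≥ r N≤q) (<⇒≱ lt)
... | no  N≰q = ≰⇒> N≰q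

couple-index-≥ : ∀ {N p} → 2 * N ≤ p → N ≤ ⌊ p /2⌋
couple-index-≥ {N} 2N≤p = subst (_≤ _) (⌊couple/2⌋ N false) (⌊n/2⌋-mono 2N≤p)

top-couple-or-above : ∀ n p → 2 * n ≤ p → (∃[ r ] p ≡ couple n r) ⊎ 2 * suc n ≤ p
top-couple-or-above n p le with ⌊ p /2⌋ ≟ n
... | yes q≡n = inj₁ (side p , trans (sym (couple-coords p)) (cong (λ q → couple q (side p)) q≡n))
... | no  q≢n = inj₂ (subst (2 * suc n ≤_) (couple-coords p)
                           (couple-≥ (side p) (≤∧≢⇒< (couple-index-≥ le) (q≢n ∘ sym))))

transpose : ℕ → ℕ → ℕ → ℕ
transpose i j q with q ≟ i | q ≟ j
... | yes _ | _     = j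
... | no _  | yes _ = i
... | no _  | no _  = q

transpose-i : ∀ i j → transpose i j i ≡ j
transpose-i i j with i ≟ i
... | yes _  = refl
... | no i≢i = contradiction refl i≢i

transpose-j : ∀ i j → transpose i j j ≡ i
transpose-j i j with j ≟ i | j ≟ j
... | yes j≡i | _     = j≡i
... | no _    | yes _ = refl
... | no _    | no j≢j = contradiction refl j≢j

transpose-other : ∀ i j q → q ≢ i → q ≢ j → transpose i j q ≡ q
transpose-other i j q q≢i q≢j with q ≟ i | q ≟ j
... | yes q≡i | _       = contradiction q≡i q≢i
... | no _    | yes q≡j = contradiction q≡j q≢j
... | no _    | no _    = refl

sum-ext : ∀ n {f g : ℕ → ℕ} → (∀ k → k < n → f k ≡ g k) → sumBelow n f ≡ sumBelow n g
sum-ext zero    f≗g = refl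
sum-ext (suc n) f≗g = cong₂ _+_ (sum-ext n (λ k k<n → f≗g k (m<n⇒m<1+n k<n))) (f≗g n ≤-refl)

sum-+ : ∀ n f g → sumBelow n (λ k → f k + g k) ≡ sumBelow n f + sumBelow n g
sum-+ zero    f g = refl
sum-+ (suc n) f g rewrite sum-+ n f g = interchange (sumBelow n f) (sumBelow n g) (f n) (g n)

sum-scale : ∀ c n f → sumBelow n (λ k → c * f k) ≡ c * sumBelow n f
sum-scale c zero    f = sym (*-zeroʳ c)
sum-scale c (suc n) f rewrite sum-scale c n f = sym (*-distribˡ-+ c (sumBelow n f) (f n))

sum-couples : ∀ N f → sumBelow (2 * N) f ≡ sumBelow N (λ q → f (couple q false) + f (couple q true))
sum-couples zero    f = refl
sum-couples (suc N) f = begin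
  sumBelow (2 * suc N) f                                         ≡⟨ cong (λ n → sumBelow n f) (*-suc 2 N) ⟩
  sumBelow (2 * N) f + f (2 * N) + f (suc (2 * N))               ≡⟨ +-assoc (sumBelow (2 * N) f) _ _ ⟩
  sumBelow (2 * N) f + (f (2 * N) + f (suc (2 * N)))             ≡⟨ cong (_+ (f (2 * N) + f (suc (2 * N)))) (sum-couples N f) ⟩
  sumBelow (suc N) (λ q → f (couple q false) + f (couple q true)) ∎
  where open ≡-Reasoning

sum-change : ∀ n {f g : ℕ → ℕ} j → j < n → (∀ k → k < n → k ≢ j → g k ≡ f k)
  → sumBelow n g + f j ≡ sumBelow n f + g j
sum-change (suc n) {f} {g} j j<1+n g≗f with j ≟ n
... | yes refl = begin
  sumBelow j g + g j + f j ≡⟨ xy∙z≈xz∙y (sumBelow j g) (g j) (f j) ⟩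
  sumBelow j g + f j + g j ≡⟨ cong (λ s → s + f j + g j) (sum-ext j (λ k k<j → g≗f k (m<n⇒m<1+n k<j) (<⇒≢ k<j))) ⟩
  sumBelow j f + f j + g j ∎
  where open ≡-Reasoning
... | no j≢n = begin
  sumBelow n g + g n + f j ≡⟨ xy∙z≈xz∙y (sumBelow n g) (g n) (f j) ⟩
  sumBelow n g + f j + g n ≡⟨ cong₂ _+_ (sum-change n j j<n (λ k k<n → g≗f k (m<n⇒m<1+n k<n))) gn≡fn ⟩
  sumBelow n f + g j + f n ≡⟨ xy∙z≈xz∙y (sumBelow n f) (g j) (f n) ⟩
  sumBelow n f + f n + g j ∎
  where
  open ≡-Reasoning
  j<n : j < n
  j<n = ≤∧≢⇒< (m<1+n⇒m≤n j<1+n) j≢n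
  gn≡fn : g n ≡ f n
  gn≡fn = g≗f n ≤-refl (j≢n ∘ sym)

sum-transpose-last : ∀ n f i → i ≤ n → sumBelow (suc n) (f ∘ transpose i n) ≡ sumBelow (suc n) f
sum-transpose-last n f i i≤n with i ≟ n
... | yes refl = cong₂ _+_ (sum-ext n (λ k k<n → cong f (transpose-other n n k (<⇒≢ k<n) (<⇒≢ k<n))))
                           (cong f (transpose-i n n))
... | no i≢n = begin
  sumBelow n (f ∘ transpose i n) + f (transpose i n n) ≡⟨ cong (λ u → sumBelow n (f ∘ transpose i n) + f u) (transpose-j i n) ⟩
  sumBelow n (f ∘ transpose i n) + f i                 ≡⟨ sum-change n i (≤∧≢⇒< i≤n i≢n) unchanged ⟩
  sumBelow n f + f (transpose i n i)                   ≡⟨ cong (λ u → sumBelow n f + f u) (transpose-i i n) ⟩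
  sumBelow n f + f n ∎
  where
  open ≡-Reasoning
  unchanged : ∀ k → k < n → k ≢ i → f (transpose i n k) ≡ f k
  unchanged k k<n k≢i = cong f (transpose-other i n k k≢i (<⇒≢ k<n))

sum<length⇒zero : ∀ n f → sumBelow n f < n → ∃[ i ] (i < n × f i ≡ 0)
sum<length⇒zero (suc n) f lt with f n ≟ 0
... | yes fn≡0 = n , ≤-refl , fn≡0
... | no  fn≢0 with sum<length⇒zero n f (≤-pred (≤-trans (s≤s one-less) lt))
  where
  one-less : suc (sumBelow n f) ≤ sumBelow n f + f n
  one-less = subst (_≤ sumBelow n f + f n) (+-comm (sumBelow n f) 1) (+-monoʳ-≤ (sumBelow n f) (n≢0⇒n>0 fn≢0))
... | i , i<n , fi≡0 = i , m<n⇒m<1+n i<n , fi≡0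

neq-≡ : ∀ {u v} → u ≡ v → neq u v ≡ 0
neq-≡ {u} {v} u≡v = cong (λ b → if b then 0 else 1) (dec-true (u ≟ v) u≡v)

neq-≢ : ∀ {u v} → u ≢ v → neq u v ≡ 1
neq-≢ {u} {v} u≢v = cong (λ b → if b then 0 else 1) (dec-false (u ≟ v) u≢v)

neq≡0⇒≡ : ∀ u v → neq u v ≡ 0 → u ≡ v
neq≡0⇒≡ u v neq≡0 with u ≟ v
... | yes u≡v = u≡v
... | no  u≢v = contradiction (trans (sym (neq-≢ u≢v)) neq≡0) λ ()

neq-resp : ∀ {u v u′ v′} → (u ≡ v → u′ ≡ v′) → (u′ ≡ v′ → u ≡ v) → neq u v ≡ neq u′ v′
neq-resp {u} {v} {u′} {v′} to from with u ≟ v | u′ ≟ v′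
... | yes e | yes e′ = trans (neq-≡ e) (sym (neq-≡ e′))
... | no ne | no ne′ = trans (neq-≢ ne) (sym (neq-≢ ne′))
... | yes e | no ne′ = contradiction (to e) ne′
... | no ne | yes e′ = contradiction (from e′) ne

involution : (f : ℕ → ℕ) → (∀ p → f (f p) ≡ p) → Perm
involution f f∘f≗id = mk↔ₛ′ f f f∘f≗id f∘f≗id

app-inv : ∀ (a : Perm) p → app a (inv a p) ≡ p
app-inv a = Inverse.strictlyInverseˡ a

inv-app : ∀ (a : Perm) p → inv a (app a p) ≡ p
inv-app a = Inverse.strictlyInverseʳ a

app-injective : ∀ (a : Perm) {u v} → app a u ≡ app a v → u ≡ v
app-injective a {u} {v} au≡av = trans (sym (inv-app a u)) (trans (cong (inv a) au≡av) (inv-app a v))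

neq-app : ∀ (a : Perm) u v → neq (app a u) (app a v) ≡ neq u v
neq-app a u v = neq-resp (app-injective a) (cong (app a))

-- Composition of permutations (b is applied first).
_∘ₚ_ : Perm → Perm → Perm
a ∘ₚ b = a ↔-∘ b

id-B∞ : InB∞ (↔-id ℕ)
id-B∞ = (0 , λ _ _ → refl) , λ _ → refl

∘-B∞ : ∀ a b → InB∞ a → InB∞ b → InB∞ (a ∘ₚ b)
∘-B∞ a b ((na , a-supp) , a-t) ((nb , b-supp) , b-t) =
  (na + nb , λ p le → trans (cong (app a) (b-supp p (≤-trans (m≤n+m nb na) le)))
                            (a-supp p (≤-trans (m≤m+n na nb) le)))
  , λ p → trans (cong (app a) (b-t p)) (a-t (app b p))

act : Perm → Perm → Perm → Perm
act a b x = a ∘ₚ (x ∘ₚ ↔-sym b)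

supported-widen : ∀ {n n′ f} → n ≤ n′ → SupportedBelow n f → SupportedBelow n′ f
supported-widen n≤n′ f-supp p n′≤p = f-supp p (≤-trans n≤n′ n′≤p)

supported-inv : ∀ {n} (a : Perm) → SupportedBelow n (app a) → SupportedBelow n (inv a)
supported-inv a a-supp p n≤p = trans (cong (inv a) (sym (a-supp p n≤p))) (inv-app a p)

supported-act : ∀ {n} (a b x : Perm) → SupportedBelow n (app a) → SupportedBelow n (app b)
  → SupportedBelow n (app x) → SupportedBelow n (app (act a b x))
supported-act a b x a-supp b-supp x-supp p n≤p =
  trans (cong (app a ∘ app x) (supported-inv b b-supp p n≤p))
        (trans (cong (app a) (x-supp p n≤p)) (a-supp p n≤p))

supported-< : ∀ {n p} (a : Perm) → SupportedBelow n (app a) → p < n → app a p < n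
supported-< {n} {p} a a-supp p<n with n ≤? app a p
... | no  n≰ap = ≰⇒> n≰ap
... | yes n≤ap = contradiction (subst (n ≤_) (app-injective a (a-supp (app a p) n≤ap)) n≤ap) (<⇒≱ p<n)

swapᶜ : ℕ → ℕ → Bool → ℕ → Bool → ℕ
swapᶜ i j e q r with q ≟ i | q ≟ j
... | yes _ | _     = couple j (r xor e)
... | no _  | yes _ = couple i (r xor e)
... | no _  | no _  = couple q r

coupleSwap : ℕ → ℕ → Bool → ℕ → ℕ
coupleSwap i j e p = swapᶜ i j e ⌊ p /2⌋ (side p)

coupleSwap-couple : ∀ i j e q r → coupleSwap i j e (couple q r) ≡ swapᶜ i j e q r
coupleSwap-couple i j e q r rewrite ⌊couple/2⌋ q r | side-couple q r = refl

coupleSwap-i : ∀ i j e r → coupleSwap i j e (couple i r) ≡ couple j (r xor e)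
coupleSwap-i i j e r with coupleSwap-couple i j e i r
... | eq with i ≟ i
...   | yes _  = eq
...   | no i≢i = contradiction refl i≢i

coupleSwap-j : ∀ i j e r → coupleSwap i j e (couple j r) ≡ couple i (r xor e)
coupleSwap-j i j e r with coupleSwap-couple i j e j r
... | eq with j ≟ i | j ≟ j
...   | yes refl | _      = eq
...   | no _     | yes _  = eq
...   | no _     | no j≢j = contradiction refl j≢j

coupleSwap-other : ∀ i j e q r → q ≢ i → q ≢ j → coupleSwap i j e (couple q r) ≡ couple q r
coupleSwap-other i j e q r q≢i q≢j with coupleSwap-couple i j e q r
... | eq with q ≟ i | q ≟ j
...   | yes q≡i | _       = contradiction q≡i q≢i
...   | no _    | yes q≡j = contradiction q≡j q≢j
...   | no _    | no _    = eq

coupleSwap-untwisted : ∀ i j q r → coupleSwap i j false (couple q r) ≡ couple (transpose i j q) r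
coupleSwap-untwisted i j q r with coupleSwap-couple i j false q r
... | eq with q ≟ i | q ≟ j
...   | yes _ | _     = trans eq (cong (couple j) (xor-identityʳ r))
...   | no _  | yes _ = trans eq (cong (couple i) (xor-identityʳ r))
...   | no _  | no _  = eq

xor-cancel : ∀ r e → (r xor e) xor e ≡ r
xor-cancel r e = trans (xor-assoc r e e) (trans (cong (r xor_) (xor-same e)) (xor-identityʳ r))

by-couples : ∀ {P : ℕ → Set} → (∀ q r → P (couple q r)) → ∀ p → P p
by-couples {P} P-couple p = subst P (couple-coords p) (P-couple ⌊ p /2⌋ (side p))

coupleSwap-involutive : ∀ i j e p → coupleSwap i j e (coupleSwap i j e p) ≡ p
coupleSwap-involutive i j e = by-couples involutive
  where
  involutive : ∀ q r → coupleSwap i j e (coupleSwap i j e (couple q r)) ≡ couple q r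
  involutive q r with q ≟ i | q ≟ j
  ... | yes refl | _ = begin
    coupleSwap q j e (coupleSwap q j e (couple q r)) ≡⟨ cong (coupleSwap q j e) (coupleSwap-i q j e r) ⟩
    coupleSwap q j e (couple j (r xor e))            ≡⟨ coupleSwap-j q j e (r xor e) ⟩
    couple q ((r xor e) xor e)                       ≡⟨ cong (couple q) (xor-cancel r e) ⟩
    couple q r ∎
    where open ≡-Reasoning
  ... | no _ | yes refl = begin
    coupleSwap i q e (coupleSwap i q e (couple q r)) ≡⟨ cong (coupleSwap i q e) (coupleSwap-j i q e r) ⟩
    coupleSwap i q e (couple i (r xor e))            ≡⟨ coupleSwap-i i q e (r xor e) ⟩
    couple q ((r xor e) xor e)                       ≡⟨ cong (couple q) (xor-cancel r e) ⟩
    couple q r ∎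
    where open ≡-Reasoning
  ... | no q≢i | no q≢j =
    trans (cong (coupleSwap i j e) (coupleSwap-other i j e q r q≢i q≢j)) (coupleSwap-other i j e q r q≢i q≢j)

coupleSwap-t : ∀ i j e p → coupleSwap i j e (t p) ≡ t (coupleSwap i j e p)
coupleSwap-t i j e = by-couples commutes
  where
  flip-after-swap : ∀ k r → couple k (not r xor e) ≡ t (couple k (r xor e))
  flip-after-swap k r = trans (cong (couple k) (sym (not-distribˡ-xor r e))) (sym (t-couple k (r xor e)))
  commutes : ∀ q r → coupleSwap i j e (t (couple q r)) ≡ t (coupleSwap i j e (couple q r))
  commutes q r rewrite t-couple q r with q ≟ i | q ≟ j
  ... | yes refl | _ =
    trans (coupleSwap-i q j e (not r)) (trans (flip-after-swap j r) (cong t (sym (coupleSwap-i q j e r))))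
  ... | no _ | yes refl =
    trans (coupleSwap-j i q e (not r)) (trans (flip-after-swap i r) (cong t (sym (coupleSwap-j i q e r))))
  ... | no q≢i | no q≢j =
    trans (coupleSwap-other i j e q (not r) q≢i q≢j)
          (trans (sym (t-couple q r)) (cong t (sym (coupleSwap-other i j e q r q≢i q≢j))))

coupleSwap-supported : ∀ {i j N} e → i < N → j < N → SupportedBelow (2 * N) (coupleSwap i j e)
coupleSwap-supported {i} {j} {N} e i<N j<N p 2N≤p =
  trans (cong (coupleSwap i j e) (sym (couple-coords p)))
        (trans (coupleSwap-other i j e q (side p) (N≤q⇒≢ i<N) (N≤q⇒≢ j<N)) (couple-coords p))
  where
  q : ℕ
  q = ⌊ p /2⌋
  N≤q⇒≢ : ∀ {k} → k < N → q ≢ k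
  N≤q⇒≢ k<N refl = <⇒≱ k<N (couple-index-≥ 2N≤p)

swapPerm : ℕ → ℕ → Bool → Perm
swapPerm i j e = involution (coupleSwap i j e) (coupleSwap-involutive i j e)

swapPerm-B∞ : ∀ {i j N} e → i < N → j < N → InB∞ (swapPerm i j e)
swapPerm-B∞ {i} {j} {N} e i<N j<N = (2 * N , coupleSwap-supported e i<N j<N) , coupleSwap-t i j e

moves : (ℕ → ℕ) → ℕ → ℕ
moves z p = neq (z p) p

defects : Perm → Perm → ℕ → ℕ
defects x y q = (moves (mul x y) (couple q false) + moves (mul x y) (couple q true)) + inD y q

defectCount : Perm → Perm → ℕ → ℕ
defectCount x y N = sumBelow N (defects x y)

-- Each defect is counted (at least) twice in 2 m_L: a moved point p of xy lies in S(xy)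
-- and t(p) in t(S(xy)), and a couple in D(y) contributes its two points to DS(y).
defectCount-bound : ∀ x y N → 2 * defectCount x y N ≤ twiceMagnitude x y N
defectCount-bound x y N = begin
  2 * sumBelow N (defects x y)                                    ≡⟨ sum-scale 2 N (defects x y) ⟨
  sumBelow N (λ q → 2 * defects x y q)                            ≡⟨ sum-ext N (λ q _ → double (A q) (B q) (C q)) ⟩
  sumBelow N (λ q → ((A q + B q) + (B q + A q)) + 2 * C q)        ≡⟨ sum-+ N _ _ ⟩
  sumBelow N (λ q → (A q + B q) + (B q + A q)) + sumBelow N (λ q → 2 * C q)
                                                                  ≡⟨ cong (_+ cardDS y N) (sum-+ N _ _) ⟩
  sumBelow N (λ q → A q + B q) + sumBelow N (λ q → B q + A q) + cardDS y N
                                                                  ≡⟨ cong (λ s → s + cardDS y N) (cong₂ _+_ S-pairs tS-pairs) ⟨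
  cardS z (2 * N) + cardtS z (2 * N) + cardDS y N                 ≤⟨ +-monoˡ-≤ (cardDS y N) (m≤m+n _ (cardDS x N)) ⟩
  twiceMagnitude x y N                                            ∎
  where
  open ≤-Reasoning
  z : ℕ → ℕ
  z = mul x y
  A B C : ℕ → ℕ
  A q = moves z (couple q false)
  B q = moves z (couple q true)
  C q = inD y q
  double : ∀ a b c → 2 * ((a + b) + c) ≡ ((a + b) + (b + a)) + 2 * c
  double = solve-∀
  S-pairs : cardS z (2 * N) ≡ sumBelow N (λ q → A q + B q)
  S-pairs = sum-couples N (moves z)
  tS-pairs : cardtS z (2 * N) ≡ sumBelow N (λ q → B q + A q)
  tS-pairs = trans (sum-couples N (moves z ∘ t))
                   (sum-ext N (λ q _ → cong₂ _+_ (cong (moves z) (t-couple q false))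
                                                 (cong (moves z) (t-couple q true))))

settled-fixed : ∀ x y i → defects x y i ≡ 0 → ∀ r → mul x y (couple i r) ≡ couple i r
settled-fixed x y i settled r = neq≡0⇒≡ _ _ (moves≡0 r)
  where
  A B : ℕ
  A = moves (mul x y) (couple i false)
  B = moves (mul x y) (couple i true)
  moves≡0 : ∀ r → moves (mul x y) (couple i r) ≡ 0
  moves≡0 false = m+n≡0⇒m≡0 A (m+n≡0⇒m≡0 (A + B) settled)
  moves≡0 true  = m+n≡0⇒n≡0 A (m+n≡0⇒m≡0 (A + B) settled)

settled-couple : ∀ x y i → defects x y i ≡ 0 → t (app y (couple i false)) ≡ app y (couple i true)
settled-couple x y i settled =
  neq≡0⇒≡ _ _ (m+n≡0⇒n≡0 (moves (mul x y) (couple i false) + moves (mul x y) (couple i true)) settled)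

defects-act : ∀ x y (a b : Perm) (σ : ℕ → ℕ)
  → (∀ q r → inv a (couple q r) ≡ couple (σ q) r) → (∀ p → app b (t p) ≡ t (app b p))
  → ∀ q → defects (act a b x) (act b a y) q ≡ defects x y (σ q)
defects-act x y a b σ a⁻¹-couples b-t q =
  cong₂ _+_ (cong₂ _+_ (moves-act false) (moves-act true)) inD-act
  where
  moves-act : ∀ r → moves (mul (act a b x) (act b a y)) (couple q r) ≡ moves (mul x y) (couple (σ q) r)
  moves-act r = begin
    neq (app a (app x (inv b (app b (app y (inv a p)))))) p
      ≡⟨ cong₂ neq (cong (app a ∘ app x) (inv-app b _)) (sym (app-inv a p)) ⟩
    neq (app a (mul x y (inv a p))) (app a (inv a p))
      ≡⟨ neq-app a _ _ ⟩
    moves (mul x y) (inv a p)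
      ≡⟨ cong (moves (mul x y)) (a⁻¹-couples q r) ⟩
    moves (mul x y) (couple (σ q) r) ∎
    where
    open ≡-Reasoning
    p : ℕ
    p = couple q r
  ya⁻¹ : Bool → ℕ
  ya⁻¹ r = app y (inv a (couple q r))
  inD-act : inD (act b a y) q ≡ inD y (σ q)
  inD-act = begin
    neq (t (app b (ya⁻¹ false))) (app b (ya⁻¹ true))  ≡⟨ cong (λ u → neq u (app b (ya⁻¹ true))) (b-t _) ⟨
    neq (app b (t (ya⁻¹ false))) (app b (ya⁻¹ true))  ≡⟨ neq-app b _ _ ⟩
    neq (t (ya⁻¹ false)) (ya⁻¹ true)                  ≡⟨ cong₂ (λ u v → neq (t (app y u)) (app y v)) (a⁻¹-couples q false) (a⁻¹-couples q true) ⟩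
    inD y (σ q)                                   ∎
    where open ≡-Reasoning

RepresentedIn : ℕ → Perm → Perm → Set
RepresentedIn m x y = ∃[ a ] ∃[ b ] (InB∞ a × InB∞ b × InS m (revL a b x) × InS m (revR a b y))

-- (a,b)·(x,y) lies in the orbit of (x,y), so its representatives serve for (x,y).
represented-pullback : ∀ {m x y} a b → InB∞ a → InB∞ b
  → RepresentedIn m (act a b x) (act b a y) → RepresentedIn m x y
represented-pullback a b a-B∞ b-B∞ (a′ , b′ , a′-B∞ , b′-B∞ , x-small , y-small) =
  a′ ∘ₚ a , b′ ∘ₚ b , ∘-B∞ a′ a a′-B∞ a-B∞ , ∘-B∞ b′ b b′-B∞ b-B∞ , x-small , y-small

represented-trivially : ∀ {N m x y} → N ≤ m
  → SupportedBelow (2 * N) (app x) → SupportedBelow (2 * N) (app y) → RepresentedIn m x y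
represented-trivially N≤m x-supp y-supp =
  ↔-id ℕ , ↔-id ℕ , id-B∞ , id-B∞ ,
  supported-widen (*-monoʳ-≤ 2 N≤m) x-supp , supported-widen (*-monoʳ-≤ 2 N≤m) y-supp

drop-top-couple : ∀ {n} (f : ℕ → ℕ) → SupportedBelow (2 * suc n) f
  → (∀ r → f (couple n r) ≡ couple n r) → SupportedBelow (2 * n) f
drop-top-couple {n} f f-supp f-top p 2n≤p with top-couple-or-above n p 2n≤p
... | inj₁ (r , refl) = f-top r
... | inj₂ 2[n+1]≤p  = f-supp p 2[n+1]≤p

module RelocateSettled (x y : Perm) (n i : ℕ)
  (x-supp : SupportedBelow (2 * suc n) (app x)) (y-supp : SupportedBelow (2 * suc n) (app y))
  (i<N : i < suc n) (settled : defects x y i ≡ 0) where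

  open ≡-Reasoning

  w k : ℕ
  w = app y (couple i false)
  k = ⌊ w /2⌋
  ε : Bool
  ε = side w

  y-onto : ∀ r → app y (couple i r) ≡ couple k (r xor ε)
  y-onto false = sym (couple-coords w)
  y-onto true  = begin
    app y (couple i true) ≡⟨ settled-couple x y i settled ⟨
    t w                   ≡⟨ cong t (couple-coords w) ⟨
    t (couple k ε)        ≡⟨ t-couple k ε ⟩
    couple k (not ε)      ∎

  k<N : k < suc n
  k<N = couple-<⁻¹ ε (subst (_< 2 * suc n) (sym (couple-coords w)) (supported-< y y-supp (couple-< false i<N)))

  a b : Perm
  a = swapPerm i n false
  b = swapPerm k n ε

  a-B∞ : InB∞ a
  a-B∞ = swapPerm-B∞ false i<N ≤-refl

  b-B∞ : InB∞ b
  b-B∞ = swapPerm-B∞ ε k<N ≤-refl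

  a-supp : SupportedBelow (2 * suc n) (app a)
  a-supp = coupleSwap-supported false i<N ≤-refl

  b-supp : SupportedBelow (2 * suc n) (app b)
  b-supp = coupleSwap-supported ε k<N ≤-refl

  x′ y′ : Perm
  x′ = act a b x
  y′ = act b a y

  x′-top : ∀ r → app x′ (couple n r) ≡ couple n r
  x′-top r = begin
    coupleSwap i n false (app x (coupleSwap k n ε (couple n r)))
      ≡⟨ cong (coupleSwap i n false ∘ app x) (trans (coupleSwap-j k n ε r) (sym (y-onto r))) ⟩
    coupleSwap i n false (mul x y (couple i r))
      ≡⟨ cong (coupleSwap i n false) (settled-fixed x y i settled r) ⟩
    coupleSwap i n false (couple i r)
      ≡⟨ trans (coupleSwap-i i n false r) (cong (couple n) (xor-identityʳ r)) ⟩
    couple n r ∎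

  y′-top : ∀ r → app y′ (couple n r) ≡ couple n r
  y′-top r = begin
    coupleSwap k n ε (app y (coupleSwap i n false (couple n r)))
      ≡⟨ cong (coupleSwap k n ε ∘ app y) (trans (coupleSwap-j i n false r) (cong (couple i) (xor-identityʳ r))) ⟩
    coupleSwap k n ε (app y (couple i r))
      ≡⟨ cong (coupleSwap k n ε) (y-onto r) ⟩
    coupleSwap k n ε (couple k (r xor ε))
      ≡⟨ trans (coupleSwap-i k n ε (r xor ε)) (cong (couple n) (xor-cancel r ε)) ⟩
    couple n r ∎

  x′-supp : SupportedBelow (2 * n) (app x′)
  x′-supp = drop-top-couple (app x′) (supported-act a b x a-supp b-supp x-supp) x′-top

  y′-supp : SupportedBelow (2 * n) (app y′)
  y′-supp = drop-top-couple (app y′) (supported-act b a y b-supp a-supp y-supp) y′-top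

  -- The defects of (x′,y′) are those of (x,y) relabelled by the transposition (i n);
  -- as D_i was settled, all of them now lie below n.
  defects′ : ∀ q → defects x′ y′ q ≡ defects x y (transpose i n q)
  defects′ = defects-act x y a b (transpose i n) (coupleSwap-untwisted i n) (coupleSwap-t k n ε)

  defectCount′ : defectCount x′ y′ n ≡ defectCount x y (suc n)
  defectCount′ = begin
    sumBelow n (defects x′ y′)                              ≡⟨ +-identityʳ _ ⟨
    sumBelow n (defects x′ y′) + 0                          ≡⟨ cong (sumBelow n (defects x′ y′) +_) top-settled ⟨
    sumBelow (suc n) (defects x′ y′)                        ≡⟨ sum-ext (suc n) (λ q _ → defects′ q) ⟩
    sumBelow (suc n) (defects x y ∘ transpose i n)          ≡⟨ sum-transpose-last n (defects x y) i (m<1+n⇒m≤n i<N) ⟩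
    sumBelow (suc n) (defects x y)                          ∎
    where
    top-settled : defects x′ y′ n ≡ 0
    top-settled = trans (defects′ n) (trans (cong (defects x y) (transpose-j i n)) settled)

-- Induction on N: while N > m some couple below N is settled, and relocating it to the top
-- brings the pair into S_{2(N-1)} × S_{2(N-1)} without changing the defect count.
represented : ∀ N x y m → SupportedBelow (2 * N) (app x) → SupportedBelow (2 * N) (app y)
  → defectCount x y N ≤ m → RepresentedIn m x y
represented N x y m x-supp y-supp count≤m with N ≤? m
... | yes N≤m = represented-trivially {x = x} {y} N≤m x-supp y-supp
represented zero    x y m x-supp y-supp count≤m | no N≰m = contradiction z≤n N≰m
represented (suc n) x y m x-supp y-supp count≤m | no N≰m
  with sum<length⇒zero (suc n) (defects x y) (≤-<-trans count≤m (≰⇒> N≰m))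
... | i , i<N , settled =
  represented-pullback {m} {x} {y} a b a-B∞ b-B∞
    (represented n x′ y′ m x′-supp y′-supp (subst (_≤ m) (sym defectCount′) count≤m))
  where open RelocateSettled x y n i x-supp y-supp i<N settled

proposition4p2 : (x y : Perm) (N : ℕ)
    → SupportedBelow (2 * N) (app x) → SupportedBelow (2 * N) (app y)
    → (m : ℕ) → 2 * m ≡ twiceMagnitude x y N
    → ∃[ a ] ∃[ b ] (InB∞ a × InB∞ b × InS m (revL a b x) × InS m (revR a b y))
proposition4p2 x y N x-supp y-supp m 2m≡2mL =
  represented N x y m x-supp y-supp (*-cancelˡ-≤ 2 count≤m)
  where
  count≤m : 2 * defectCount x y N ≤ 2 * m
  count≤m = subst (2 * defectCount x y N ≤_) (sym 2m≡2mL) (defectCount-bound x y N)
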